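{- Let $b$ be an outer vertex and let $t\le t'$ be odd numbers with $t'<t(b)$ and $t'<l_m$, and consider the blossoms $\mathcal{B}_{b,t}$ and $\mathcal{B}_{b,t'}$ with the same base $b$. Then $\mathcal{B}_{b,t}\subseteq\mathcal{B}_{b,t'}$.
   Context: $G=(V,E)$ is a finite undirected graph with a matching $M$, with at least one unmatched vertex. Alternating paths are simple paths alternating between unmatched edges (not in $M$) and matched edges (in $M$), starting with an unmatched edge when starting at an unmatched vertex. $l_m$ is the minimum length of an augmenting path (alternating path between two distinct unmatched vertices), $\infty$ if none. $\mathrm{evenlevel}(v)$, $\mathrm{oddlevel}(v)$ are the minimum lengths of even, resp. odd, alternating paths from an unmatched vertex to $v$ ($\infty$ if none); such minimum paths are $\mathrm{evenlevel}(v)$, $\mathrm{oddlevel}(v)$ paths. Tenacity $t(v)=\mathrm{evenlevel}(v)+\mathrm{oddlevel}(v)$. A vertex is outer if $\mathrm{evenlevel}(v)<\mathrm{oddlevel}(v)$. For $t(v)=t<l_m$, $\mathrm{base}(v)$ is the vertex of tenacity $>t$ furthest from the starting unmatched vertex along any $\mathrm{evenlevel}(v)$ or $\mathrm{oddlevel}(v)$ path (known to be independent of the path). Blossoms: for an outer vertex $b$ and an odd number $t$ with $t<t(b)$ and $t<l_m$, $\mathcal{B}_{b,1}=\emptyset$, and for $t\ge3$, with $S_{b,t}=\{v: t(v)=t,\ \mathrm{base}(v)=b\}$, $\mathcal{B}_{b,t}=S_{b,t}\cup\bigcup_{v\in S_{b,t}\cup\{b\},\ v\text{ outer}}\mathcal{B}_{v,t-2}$.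 -}

module Defs where

open import Data.Nat using (ℕ; zero; suc; _+_; _≤_; _<_)
open import Data.Bool using (Bool; true; false; not; if_then_else_)
open import Data.Fin using (Fin)
open import Data.List using (List; []; _∷_; _++_)
open import Data.List.Relation.Unary.All using (All)
open import Data.List.Membership.Propositional using (_∉_)
open import Data.Product using (Σ; _×_; ∃; ∃-syntax)
open import Data.Sum using (_⊎_)
open import Data.Empty using (⊥)
open import Relation.Nullary using (¬_)
open import Relation.Binary.PropositionalEquality using (_≡_; _≢_)

data ℕ∞ : Set where
  fin : ℕ → ℕ∞
  ∞   : ℕ∞

_+∞_ : ℕ∞ → ℕ∞ → ℕ∞
fin m +∞ fin n = fin (m + n)
fin _ +∞ ∞     = ∞
∞     +∞ _     = ∞

data _<∞_ : ℕ∞ → ℕ∞ → Set where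
  fin<fin : ∀ {m n} → m < n → fin m <∞ fin n
  fin<∞   : ∀ {m} → fin m <∞ ∞

odd : ℕ → Bool
odd zero    = false
odd (suc n) = not (odd n)

Odd : ℕ → Set
Odd n = odd n ≡ true

MinLen : (ℕ → Set) → ℕ∞ → Set
MinLen P (fin k) = P k × (∀ k′ → P k′ → k ≤ k′)
MinLen P ∞       = ∀ k → ¬ P k

record Graph (n : ℕ) : Set₁ where
  field
    Adj     : Fin n → Fin n → Set
    sym     : ∀ {u v} → Adj u v → Adj v u
    irrefl  : ∀ {u} → ¬ Adj u u

record Matching {n : ℕ} (G : Graph n) : Set₁ where
  open Graph G
  field
    M       : Fin n → Fin n → Set
    M⊆E     : ∀ {u v} → M u v → Adj u v
    M-sym   : ∀ {u v} → M u v → M v u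
    M-uniq  : ∀ {u v w} → M u v → M u w → v ≡ w

module _ {n : ℕ} {G : Graph n} (Mt : Matching G) where
  open Graph G
  open Matching Mt

  Unmatched : Fin n → Set
  Unmatched v = ∀ u → ¬ M v u

  -- the edge with index k (from the k-th to the (k+1)-th vertex) of an
  -- alternating path starting at an unmatched vertex is matched iff k is odd
  EdgeCond : ℕ → Fin n → Fin n → Set
  EdgeCond k u w = if odd k then M u w else ¬ M u w

  -- AltPath s k v vs : a simple alternating path starting at the unmatched
  -- vertex s, with k edges, ending at v; vs lists its vertices from v back to s.
  data AltPath (s : Fin n) : ℕ → Fin n → List (Fin n) → Set where
    start : Unmatched s → AltPath s 0 s (s ∷ [])
    step  : ∀ {k u w vs} → AltPath s k u vs → Adj u w → EdgeCond k u w →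
            w ∉ vs → AltPath s (suc k) w (w ∷ vs)

  EvenAlt : Fin n → ℕ → Set
  EvenAlt v k = odd k ≡ false × Σ (Fin n) λ s → Σ (List (Fin n)) λ vs → AltPath s k v vs

  OddAlt : Fin n → ℕ → Set
  OddAlt v k = odd k ≡ true × Σ (Fin n) λ s → Σ (List (Fin n)) λ vs → AltPath s k v vs

  AugAlt : ℕ → Set
  AugAlt k = Σ (Fin n) λ s → Σ (Fin n) λ v → Σ (List (Fin n)) λ vs →
             AltPath s k v vs × Unmatched v × s ≢ v

  IsEvenLevel : (Fin n → ℕ∞) → Set
  IsEvenLevel el = ∀ v → MinLen (EvenAlt v) (el v)

  IsOddLevel : (Fin n → ℕ∞) → Set
  IsOddLevel ol = ∀ v → MinLen (OddAlt v) (ol v)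

  IsLm : ℕ∞ → Set
  IsLm lm = MinLen AugAlt lm

  module Levels (el ol : Fin n → ℕ∞) where

    tenacity : Fin n → ℕ∞
    tenacity v = el v +∞ ol v

    Outer : Fin n → Set
    Outer v = el v <∞ ol v

    -- IsBase t v b : (for t(v) = t) b is the vertex of tenacity > t that is
    -- furthest from the starting unmatched vertex along an evenlevel(v) or
    -- oddlevel(v) path.  (vs lists the path from v back to its start, so the
    -- furthest such vertex is the first one in vs with tenacity > t.)
    IsBase : ℕ → Fin n → Fin n → Set
    IsBase t v b =
      Σ (Fin n) λ s → Σ ℕ λ k → Σ (List (Fin n)) λ vs →
        AltPath s k v vs × (el v ≡ fin k ⊎ ol v ≡ fin k) ×
        Σ (List (Fin n)) λ pre → Σ (List (Fin n)) λ post →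
          vs ≡ pre ++ (b ∷ post) ×
          All (λ x → ¬ (fin t <∞ tenacity x)) pre ×
          fin t <∞ tenacity b

    InS : Fin n → ℕ → Fin n → Set
    InS b t v = tenacity v ≡ fin t × IsBase t v b

    -- InBlossom b t w : w ∈ 𝓑_{b,t}.  𝓑_{b,1} = ∅ (no constructor for t = 1), and
    -- 𝓑_{b,t} = S_{b,t} ∪ ⋃_{v ∈ S_{b,t} ∪ {b}, v outer} 𝓑_{v,t-2}.
    data InBlossom : Fin n → ℕ → Fin n → Set where
      inS   : ∀ {b t w} → InS b (suc (suc t)) w → InBlossom b (suc (suc t)) w
      viaB  : ∀ {b t w} → Outer b → InBlossom b t w → InBlossom b (suc (suc t)) w
      viaS  : ∀ {b t v w} → InS b (suc (suc t)) v → Outer v → InBlossom v t w →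
              InBlossom b (suc (suc t)) w

-- Because b is outer, the clause 𝓑_{b,t-2} ⊆ 𝓑_{b,t} of the definition applies
-- at every odd level, and iterating it along t, t+2, …, t′ gives the inclusion.
-- None of the level hypotheses (evenlevel, oddlevel, l_m, the bounds on t′) is needed.
module Submission where

open import Defs
open import Data.Nat using (ℕ; zero; suc; _≤_; s≤s; z≤n)
open import Data.Nat.Properties using (m≤n⇒m<n∨m≡n)
open import Data.Fin using (Fin)
open import Data.Product using (∃)
open import Data.Sum using (inj₁; inj₂)
open import Data.Empty using (⊥-elim)
open import Data.Bool.Properties using (not-involutive; not-¬)
open import Relation.Binary.PropositionalEquality using (_≡_; refl; sym; trans)

odd-suc-suc : ∀ k → odd (suc (suc k)) ≡ odd k
odd-suc-suc k = not-involutive (odd k)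

data _≤₂_ (m : ℕ) : ℕ → Set where
  ≤₂-refl : m ≤₂ m
  ≤₂-step : ∀ {n} → m ≤₂ n → m ≤₂ suc (suc n)

≤∧same-parity⇒≤₂ : ∀ {m n} → m ≤ n → odd m ≡ odd n → m ≤₂ n
≤∧same-parity⇒≤₂ m≤n eq with m≤n⇒m<n∨m≡n m≤n
≤∧same-parity⇒≤₂ _ _ | inj₂ refl = ≤₂-refl
≤∧same-parity⇒≤₂ {n = suc zero} _ () | inj₁ (s≤s z≤n)
≤∧same-parity⇒≤₂ {n = suc (suc k)} _ eq | inj₁ (s≤s m≤1+k) with m≤n⇒m<n∨m≡n m≤1+k
... | inj₂ refl = ⊥-elim (not-¬ refl eq)
... | inj₁ (s≤s m≤k) = ≤₂-step (≤∧same-parity⇒≤₂ m≤k (trans eq (odd-suc-suc k)))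

≤₂-lift : ∀ (P : ℕ → Set) → (∀ {t} → P t → P (suc (suc t))) →
          ∀ {m n} → m ≤₂ n → P m → P n
≤₂-lift P next ≤₂-refl        p = p
≤₂-lift P next (≤₂-step m≤₂n) p = next (≤₂-lift P next m≤₂n p)

lemma8 : ∀ {n} (G : Graph n) (Mt : Matching G) →
    ∃ (λ v → Unmatched Mt v) →
    (el ol : Fin n → ℕ∞) (lm : ℕ∞) →
    IsEvenLevel Mt el → IsOddLevel Mt ol → IsLm Mt lm →
    (b : Fin n) (t t′ : ℕ) →
    Levels.Outer Mt el ol b →
    Odd t → Odd t′ → t ≤ t′ →
    fin t′ <∞ Levels.tenacity Mt el ol b → fin t′ <∞ lm →
    ∀ w → Levels.InBlossom Mt el ol b t w → Levels.InBlossom Mt el ol b t′ w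
lemma8 G Mt _ el ol lm _ _ _ b t t′ b-outer odd-t odd-t′ t≤t′ _ _ w =
  ≤₂-lift (λ s → InBlossom b s w) (viaB b-outer)
          (≤∧same-parity⇒≤₂ t≤t′ (trans odd-t (sym odd-t′)))
  where
    open Levels Mt el ol
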